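{- For all nonnegative integers $n,k,i$ with $i\leq k$, $$\sum_{p=1}^{\lceil \frac{n+1}{2}\rceil}\ \sum_{q=1}^{\min\{n+3-2p,\,k+1-i\}} \frac{(-1)^{q-p}\,2^{n-p}}{(n+3-2p-q)!\,(p-1)!}\binom{k-i}{q-1}\frac{(2n+4k-2p-2q+1-i)!!}{(4k-3-i)!!}=2^{n-1}\binom{n+3k-2}{n}.$$
   Context: The ratio of double factorials is understood as follows. Put $a=4k-3-i$ and $r=n+2-p-q$; note that $r\geq 0$ in the range of summation. Then $$\frac{(a+2r)!!}{a!!}:=\prod_{j=1}^{r}(a+2j),$$ which is the usual value whenever both double factorials are defined. The binomial $\binom{x}{n}=x(x-1)\cdots(x-n+1)/n!$ is the generalized binomial coefficient, so it is defined even when $x$ is negative. -}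

module Defs where

open import Data.Nat as ℕ using (ℕ; zero; suc; _∸_; _⊓_; ⌈_/2⌉)
open import Data.Nat.Properties using (_!≢0; m^n≢0)
open import Data.Nat.Combinatorics using (_C_)
open import Data.Integer as ℤ using (ℤ; +_; -[1+_])
open import Data.Rational using (ℚ; 0ℚ; 1ℚ; _+_; _*_; _-_; -_; _/_)

ℕ→ℚ : ℕ → ℚ
ℕ→ℚ n = + n / 1

ℤ→ℚ : ℤ → ℚ
ℤ→ℚ z = z / 1

_^ℚ_ : ℚ → ℕ → ℚ
q ^ℚ zero = 1ℚ
q ^ℚ suc m = q * (q ^ℚ m)

pow2ℤ : ℤ → ℚ
pow2ℤ (+ m) = ℕ→ℚ (2 ℕ.^ m)
pow2ℤ -[1+ m ] = _/_ (+ 1) (2 ℕ.^ suc m) {{m^n≢0 2 (suc m)}}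

negOnePowℤ : ℤ → ℚ
negOnePowℤ z = (- 1ℚ) ^ℚ ℤ.∣ z ∣

invFact : ℕ → ℚ
invFact m = _/_ (+ 1) (m ℕ.!) {{m !≢0}}

-- ∑_{j=a}^{b} f j  (empty if b < a); defined as ∑_{t=0}^{b+1-a-1} f (a+t)
sumFromTo : ℕ → ℕ → (ℕ → ℚ) → ℚ
sumFromTo a b f = go (suc b ∸ a)
  where
  go : ℕ → ℚ
  go zero = 0ℚ
  go (suc t) = go t + f (a ℕ.+ t)

-- (a+2r)!! / a!!  :=  ∏_{j=1}^{r} (a + 2j)   for integer a
dfRatio : ℤ → ℕ → ℚ
dfRatio a zero = 1ℚ
dfRatio a (suc r) = dfRatio a r * ℤ→ℚ (a ℤ.+ + (2 ℕ.* suc r))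

falling : ℚ → ℕ → ℚ
falling x zero = 1ℚ
falling x (suc m) = falling x m * (x - ℕ→ℚ m)

genBinom : ℚ → ℕ → ℚ
genBinom x m = falling x m * invFact m

term : ℕ → ℕ → ℕ → ℕ → ℕ → ℚ
term n k i p q =
  negOnePowℤ (+ q ℤ.- + p)
  * pow2ℤ (+ n ℤ.- + p)
  * invFact (n ℕ.+ 3 ∸ 2 ℕ.* p ∸ q)
  * invFact (p ∸ 1)
  * ℕ→ℚ ((k ∸ i) C (q ∸ 1))
  * dfRatio (+ (4 ℕ.* k) ℤ.- + 3 ℤ.- + i) (n ℕ.+ 2 ∸ p ∸ q)

lhs : ℕ → ℕ → ℕ → ℚ
lhs n k i =
  sumFromTo 1 ⌈ suc n /2⌉ λ p →
    sumFromTo 1 ((n ℕ.+ 3 ∸ 2 ℕ.* p) ⊓ (k ℕ.+ 1 ∸ i)) λ q →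
      term n k i p q

rhs : ℕ → ℕ → ℚ
rhs n k = pow2ℤ (+ n ℤ.- + 1) * genBinom (ℤ→ℚ (+ (n ℕ.+ 3 ℕ.* k) ℤ.- + 2)) n

-- Put p = t + 1, q = u + 1 and s = n − 2t − u. Writing a = 4k − 3 − i, x = a + 2, m = k − i and
-- D(r) = ∏_{j=1}^{r} (a + 2j), the summand becomes 2^{n−1} (−1)^u C(m,u) f(t,s) with
-- f(t,s) = (−1)^t 2^{−t} D(t+s) / (s! t!). For fixed N = n − u, the sum E(N) of f(t,s) over
-- 2t + s = N satisfies (N+1) E(N+1) = (x+N) E(N), because (s+1) f(t,s+1) = (x+2t+2s) f(t,s) and
-- 2(t+1) f(t+1,s) = −(s+1) f(t,s+1); hence E(N) = binom(x+N−1, N). What is left is the alternating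
-- convolution ∑_u (−1)^u C(m,u) binom(x+n−u−1, n−u) = binom(x−m+n−1, n), proved by Pascal's rule and
-- induction on m, and x − m + n − 1 = n + 3k − 2.

module Submission where

open import Defs
open import Data.Nat using (ℕ; _≤_)
open import Data.Rational using (ℚ)
open import Relation.Binary.PropositionalEquality using (_≡_)

open import Data.Nat as ℕ using (zero; suc; _∸_; _<_; _⊓_; ⌊_/2⌋; z≤n; s≤s; _!)
import Data.Nat.Properties as ℕₚ
import Data.Nat.Tactic.RingSolver as ℕ-Solver
open import Data.Nat.Combinatorics using (_C_; nCk+nC[k+1]≡[n+1]C[k+1]; k>n⇒nCk≡0)
open import Data.Integer as ℤ using (ℤ; +_; -[1+_])
import Data.Integer.Properties as ℤₚ
import Data.Integer.Tactic.RingSolver as ℤ-Solver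
open import Data.Rational using (0ℚ; 1ℚ; ½; _+_; _*_; _-_; -_; _/_; toℚᵘ; fromℚᵘ)
import Data.Rational.Properties as ℚₚ
open import Data.Rational.Unnormalised as ℚᵘ using (ℚᵘ; mkℚᵘ; *≡*; _≃_)
import Data.Rational.Unnormalised.Properties as ℚᵘₚ
open import Data.Empty using (⊥-elim)
open import Data.Product using (_,_)
open import Data.Sum using (inj₁; inj₂)
open import Level using (0ℓ)
open import Algebra.Definitions (_≃_) using (Congruent₂)
open import Algebra.Morphism.Definitions ℚ ℚᵘ _≃_ using (Homomorphic₂)
open import Relation.Nullary using (yes; no)
open import Relation.Nullary.Decidable using (dec⇒maybe)
open import Relation.Binary.PropositionalEquality
  using (refl; sym; trans; cong; cong₂; subst; subst₂; module ≡-Reasoning)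
open import Tactic.RingSolver using (solve-∀)
open import Tactic.RingSolver.Core.AlmostCommutativeRing using (AlmostCommutativeRing; fromCommutativeRing)

ℚ-ring : AlmostCommutativeRing 0ℓ 0ℓ
ℚ-ring = fromCommutativeRing ℚₚ.+-*-commutativeRing (λ x → dec⇒maybe (0ℚ ℚₚ.≟ x))

fromℚᵘ-homo₂ : ∀ {_∙_ : ℚ → ℚ → ℚ} {_∘_ : ℚᵘ → ℚᵘ → ℚᵘ} →
               Homomorphic₂ toℚᵘ _∙_ _∘_ → Congruent₂ _∘_ →
               ∀ p q → fromℚᵘ (p ∘ q) ≡ fromℚᵘ p ∙ fromℚᵘ q
fromℚᵘ-homo₂ {_∘_ = _∘_} homo cong∘ p q = ℚₚ.toℚᵘ-injective (ℚᵘₚ.≃-trans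
  (ℚₚ.toℚᵘ-fromℚᵘ (p ∘ _))
  (ℚᵘₚ.≃-trans (cong∘ (ℚᵘₚ.≃-sym (ℚₚ.toℚᵘ-fromℚᵘ p)) (ℚᵘₚ.≃-sym (ℚₚ.toℚᵘ-fromℚᵘ q)))
               (ℚᵘₚ.≃-sym (homo (fromℚᵘ p) (fromℚᵘ q)))))

fromℚᵘ-homo-+ : ∀ p q → fromℚᵘ (p ℚᵘ.+ q) ≡ fromℚᵘ p + fromℚᵘ q
fromℚᵘ-homo-+ = fromℚᵘ-homo₂ ℚₚ.toℚᵘ-homo-+ ℚᵘₚ.+-cong

fromℚᵘ-homo-* : ∀ p q → fromℚᵘ (p ℚᵘ.* q) ≡ fromℚᵘ p * fromℚᵘ q
fromℚᵘ-homo-* = fromℚᵘ-homo₂ ℚₚ.toℚᵘ-homo-* ℚᵘₚ.*-cong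

fromℚᵘ-homo‿- : ∀ p → fromℚᵘ (ℚᵘ.- p) ≡ - fromℚᵘ p
fromℚᵘ-homo‿- p = ℚₚ.toℚᵘ-injective (ℚᵘₚ.≃-trans (ℚₚ.toℚᵘ-fromℚᵘ (ℚᵘ.- p))
  (ℚᵘₚ.≃-trans (ℚᵘₚ.-‿cong (ℚᵘₚ.≃-sym (ℚₚ.toℚᵘ-fromℚᵘ p)))
               (ℚᵘₚ.≃-sym (ℚₚ.toℚᵘ-homo‿- (fromℚᵘ p)))))

ℤ→ℚ-homo-+ : ∀ a b → ℤ→ℚ (a ℤ.+ b) ≡ ℤ→ℚ a + ℤ→ℚ b
ℤ→ℚ-homo-+ a b = trans (ℚₚ.fromℚᵘ-cong {mkℚᵘ (a ℤ.+ b) 0} {mkℚᵘ a 0 ℚᵘ.+ mkℚᵘ b 0}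
    (*≡* (cross-multiplied a b))) (fromℚᵘ-homo-+ (mkℚᵘ a 0) (mkℚᵘ b 0))
  where
  cross-multiplied : ∀ a b → (a ℤ.+ b) ℤ.* + 1 ≡ (a ℤ.* + 1 ℤ.+ b ℤ.* + 1) ℤ.* + 1
  cross-multiplied = ℤ-Solver.solve-∀

ℤ→ℚ-homo-* : ∀ a b → ℤ→ℚ (a ℤ.* b) ≡ ℤ→ℚ a * ℤ→ℚ b
ℤ→ℚ-homo-* a b = fromℚᵘ-homo-* (mkℚᵘ a 0) (mkℚᵘ b 0)

ℤ→ℚ-homo-- : ∀ a b → ℤ→ℚ (a ℤ.- b) ≡ ℤ→ℚ a - ℤ→ℚ b
ℤ→ℚ-homo-- a b = trans (ℤ→ℚ-homo-+ a (ℤ.- b)) (cong (λ q → ℤ→ℚ a + q) (fromℚᵘ-homo‿- (mkℚᵘ b 0)))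

ℕ→ℚ-homo-+ : ∀ m n → ℕ→ℚ (m ℕ.+ n) ≡ ℕ→ℚ m + ℕ→ℚ n
ℕ→ℚ-homo-+ m n = ℤ→ℚ-homo-+ (+ m) (+ n)

ℕ→ℚ-homo-* : ∀ m n → ℕ→ℚ (m ℕ.* n) ≡ ℕ→ℚ m * ℕ→ℚ n
ℕ→ℚ-homo-* m n = trans (cong ℤ→ℚ (ℤₚ.pos-* m n)) (ℤ→ℚ-homo-* (+ m) (+ n))

1/n*n≡1 : ∀ n .{{_ : ℕ.NonZero n}} → (+ 1 / n) * ℕ→ℚ n ≡ 1ℚ
1/n*n≡1 (suc n) = trans (sym (fromℚᵘ-homo-* (mkℚᵘ (+ 1) n) (mkℚᵘ (+ suc n) 0)))
  (ℚₚ.fromℚᵘ-cong {mkℚᵘ (+ 1) n ℚᵘ.* mkℚᵘ (+ suc n) 0} {ℚᵘ.1ℚᵘ}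
    (*≡* (cong (λ d → + suc d) (ℕₚ.*-distribʳ-+ 1 n 0))))

ℕ→ℚ-*-cancelˡ : ∀ n .{{_ : ℕ.NonZero n}} {x y : ℚ} → ℕ→ℚ n * x ≡ ℕ→ℚ n * y → x ≡ y
ℕ→ℚ-*-cancelˡ n {x} {y} eq = begin
  x                       ≡⟨ 1/n*[n*z]≡z x ⟨
  (+ 1 / n) * (ℕ→ℚ n * x) ≡⟨ cong ((+ 1 / n) *_) eq ⟩
  (+ 1 / n) * (ℕ→ℚ n * y) ≡⟨ 1/n*[n*z]≡z y ⟩
  y                       ∎
  where
  open ≡-Reasoning
  1/n*[n*z]≡z : ∀ z → (+ 1 / n) * (ℕ→ℚ n * z) ≡ z
  1/n*[n*z]≡z z = trans (sym (ℚₚ.*-assoc (+ 1 / n) (ℕ→ℚ n) z)) (trans (cong (_* z) (1/n*n≡1 n)) (ℚₚ.*-identityˡ z))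

invFact-inverse : ∀ s → invFact s * ℕ→ℚ (s !) ≡ 1ℚ
invFact-inverse s = 1/n*n≡1 (s !) {{s ℕₚ.!≢0}}

invFact-suc : ∀ s → invFact (suc s) * ℕ→ℚ (suc s) ≡ invFact s
invFact-suc s = ℕ→ℚ-*-cancelˡ (s !) {{s ℕₚ.!≢0}} (begin
  ℕ→ℚ (s !) * (invFact (suc s) * ℕ→ℚ (suc s)) ≡⟨ rotate (ℕ→ℚ (s !)) (invFact (suc s)) (ℕ→ℚ (suc s)) ⟩
  invFact (suc s) * (ℕ→ℚ (suc s) * ℕ→ℚ (s !)) ≡⟨ cong (invFact (suc s) *_) (ℕ→ℚ-homo-* (suc s) (s !)) ⟨
  invFact (suc s) * ℕ→ℚ (suc s !)             ≡⟨ invFact-inverse (suc s) ⟩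
  1ℚ                                          ≡⟨ invFact-inverse s ⟨
  invFact s * ℕ→ℚ (s !)                       ≡⟨ ℚₚ.*-comm (invFact s) (ℕ→ℚ (s !)) ⟩
  ℕ→ℚ (s !) * invFact s                       ∎)
  where
  open ≡-Reasoning
  rotate : ∀ x y z → x * (y * z) ≡ y * (z * x)
  rotate = solve-∀ ℚ-ring

1/[m*n]≡1/m*1/n : ∀ m n .{{_ : ℕ.NonZero m}} .{{_ : ℕ.NonZero n}} →
                  _/_ (+ 1) (m ℕ.* n) {{ℕₚ.m*n≢0 m n}} ≡ (+ 1 / m) * (+ 1 / n)
1/[m*n]≡1/m*1/n (suc m) (suc n) = fromℚᵘ-homo-* (mkℚᵘ (+ 1) m) (mkℚᵘ (+ 1) n)

pow2ℤ-pred : ∀ z → pow2ℤ (z ℤ.- + 1) ≡ pow2ℤ z * ½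
pow2ℤ-pred (+ zero)  = refl
pow2ℤ-pred (+ suc m) = sym (begin
  ℕ→ℚ (2 ℕ.* 2 ℕ.^ m) * ½     ≡⟨ cong (_* ½) (ℕ→ℚ-homo-* 2 (2 ℕ.^ m)) ⟩
  ℕ→ℚ 2 * ℕ→ℚ (2 ℕ.^ m) * ½  ≡⟨ halve (ℕ→ℚ (2 ℕ.^ m)) ⟩
  ℕ→ℚ (2 ℕ.^ m)               ∎)
  where
  open ≡-Reasoning
  halve : ∀ x → ℕ→ℚ 2 * x * ½ ≡ x
  halve = solve-∀ ℚ-ring
pow2ℤ-pred -[1+ m ] = begin
  pow2ℤ (-[1+ m ] ℤ.- + 1)          ≡⟨ cong (λ j → pow2ℤ -[1+ suc j ]) (ℕₚ.+-identityʳ m) ⟩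
  pow2ℤ -[1+ suc m ]                ≡⟨ 1/[m*n]≡1/m*1/n 2 (2 ℕ.^ suc m) {{_}} {{ℕₚ.m^n≢0 2 (suc m)}} ⟩
  ½ * pow2ℤ -[1+ m ]                ≡⟨ ℚₚ.*-comm ½ (pow2ℤ -[1+ m ]) ⟩
  pow2ℤ -[1+ m ] * ½                ∎
  where open ≡-Reasoning

^ℚ-+ : ∀ q a b → q ^ℚ (a ℕ.+ b) ≡ q ^ℚ a * q ^ℚ b
^ℚ-+ q zero    b = sym (ℚₚ.*-identityˡ (q ^ℚ b))
^ℚ-+ q (suc a) b = trans (cong (q *_) (^ℚ-+ q a b)) (sym (ℚₚ.*-assoc q (q ^ℚ a) (q ^ℚ b)))

[-1]^n*[-1]^n≡1 : ∀ n → (- 1ℚ) ^ℚ n * (- 1ℚ) ^ℚ n ≡ 1ℚ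
[-1]^n*[-1]^n≡1 zero    = refl
[-1]^n*[-1]^n≡1 (suc n) = trans (cancel-signs ((- 1ℚ) ^ℚ n)) ([-1]^n*[-1]^n≡1 n)
  where
  cancel-signs : ∀ x → (- 1ℚ * x) * (- 1ℚ * x) ≡ x * x
  cancel-signs = solve-∀ ℚ-ring

[-1]^[n∸m] : ∀ {m n} → m ≤ n → (- 1ℚ) ^ℚ (n ∸ m) ≡ (- 1ℚ) ^ℚ m * (- 1ℚ) ^ℚ n
[-1]^[n∸m] {m} {n} m≤n = begin
  σ (n ∸ m)               ≡⟨ ℚₚ.*-identityˡ (σ (n ∸ m)) ⟨
  1ℚ * σ (n ∸ m)          ≡⟨ cong (_* σ (n ∸ m)) ([-1]^n*[-1]^n≡1 m) ⟨
  σ m * σ m * σ (n ∸ m)   ≡⟨ ℚₚ.*-assoc (σ m) (σ m) (σ (n ∸ m)) ⟩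
  σ m * (σ m * σ (n ∸ m)) ≡⟨ cong (σ m *_) (^ℚ-+ (- 1ℚ) m (n ∸ m)) ⟨
  σ m * σ (m ℕ.+ (n ∸ m)) ≡⟨ cong (λ j → σ m * σ j) (ℕₚ.m+[n∸m]≡n m≤n) ⟩
  σ m * σ n               ∎
  where
  open ≡-Reasoning
  σ : ℕ → ℚ
  σ j = (- 1ℚ) ^ℚ j

negOnePowℤ-- : ∀ a b → negOnePowℤ (+ a ℤ.- + b) ≡ (- 1ℚ) ^ℚ a * (- 1ℚ) ^ℚ b
negOnePowℤ-- a b with ℕₚ.≤-total a b
... | inj₁ a≤b = begin
  (- 1ℚ) ^ℚ ℤ.∣ + a ℤ.- + b ∣ ≡⟨ cong (λ z → (- 1ℚ) ^ℚ ℤ.∣ z ∣) (ℤₚ.m-n≡m⊖n a b) ⟩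
  (- 1ℚ) ^ℚ ℤ.∣ a ℤ.⊖ b ∣     ≡⟨ cong ((- 1ℚ) ^ℚ_) (ℤₚ.∣⊖∣-≤ a≤b) ⟩
  (- 1ℚ) ^ℚ (b ∸ a)           ≡⟨ [-1]^[n∸m] a≤b ⟩
  (- 1ℚ) ^ℚ a * (- 1ℚ) ^ℚ b   ∎
  where open ≡-Reasoning
... | inj₂ b≤a = begin
  (- 1ℚ) ^ℚ ℤ.∣ + a ℤ.- + b ∣ ≡⟨ cong (λ z → (- 1ℚ) ^ℚ ℤ.∣ z ∣) (ℤₚ.m-n≡m⊖n a b) ⟩
  (- 1ℚ) ^ℚ ℤ.∣ a ℤ.⊖ b ∣     ≡⟨ cong ((- 1ℚ) ^ℚ_) (trans (ℤₚ.∣m⊖n∣≡∣n⊖m∣ a b) (ℤₚ.∣⊖∣-≤ b≤a)) ⟩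
  (- 1ℚ) ^ℚ (a ∸ b)           ≡⟨ [-1]^[n∸m] b≤a ⟩
  (- 1ℚ) ^ℚ b * (- 1ℚ) ^ℚ a   ≡⟨ ℚₚ.*-comm ((- 1ℚ) ^ℚ b) ((- 1ℚ) ^ℚ a) ⟩
  (- 1ℚ) ^ℚ a * (- 1ℚ) ^ℚ b   ∎
  where open ≡-Reasoning

pow2ℤ-[n-1-t] : ∀ n t → pow2ℤ (+ n ℤ.- + suc t) ≡ pow2ℤ (+ n ℤ.- + 1) * ½ ^ℚ t
pow2ℤ-[n-1-t] n zero    = sym (ℚₚ.*-identityʳ _)
pow2ℤ-[n-1-t] n (suc t) = begin
  pow2ℤ (+ n ℤ.- + suc (suc t))       ≡⟨ cong pow2ℤ (subtract-suc (+ n) (+ suc t)) ⟩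
  pow2ℤ (+ n ℤ.- + suc t ℤ.- + 1)     ≡⟨ pow2ℤ-pred (+ n ℤ.- + suc t) ⟩
  pow2ℤ (+ n ℤ.- + suc t) * ½         ≡⟨ cong (_* ½) (pow2ℤ-[n-1-t] n t) ⟩
  pow2ℤ (+ n ℤ.- + 1) * ½ ^ℚ t * ½    ≡⟨ ℚₚ.*-assoc (pow2ℤ (+ n ℤ.- + 1)) (½ ^ℚ t) ½ ⟩
  pow2ℤ (+ n ℤ.- + 1) * (½ ^ℚ t * ½)  ≡⟨ cong (pow2ℤ (+ n ℤ.- + 1) *_) (ℚₚ.*-comm (½ ^ℚ t) ½) ⟩
  pow2ℤ (+ n ℤ.- + 1) * ½ ^ℚ suc t    ∎
  where
  open ≡-Reasoning
  subtract-suc : ∀ x y → x ℤ.- (+ 1 ℤ.+ y) ≡ x ℤ.- y ℤ.- + 1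
  subtract-suc = ℤ-Solver.solve-∀

∑< : ℕ → (ℕ → ℚ) → ℚ
∑< zero    f = 0ℚ
∑< (suc n) f = ∑< n f + f n

syntax ∑< n (λ j → e) = ∑[ j < n ] e

sumFromTo-1 : ∀ b f → sumFromTo 1 b f ≡ ∑[ j < b ] f (suc j)
sumFromTo-1 zero    f = refl
sumFromTo-1 (suc b) f = cong (_+ f (suc b)) (sumFromTo-1 b f)

∑<-cong : ∀ n {f g : ℕ → ℚ} → (∀ j → j < n → f j ≡ g j) → ∑< n f ≡ ∑< n g
∑<-cong zero    f≗g = refl
∑<-cong (suc n) f≗g = cong₂ _+_ (∑<-cong n (λ j j<n → f≗g j (ℕₚ.m<n⇒m<1+n j<n))) (f≗g n ℕₚ.≤-refl)

∑<-zero : ∀ n (f : ℕ → ℚ) → (∀ j → j < n → f j ≡ 0ℚ) → ∑< n f ≡ 0ℚ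
∑<-zero n f f≗0 = trans (∑<-cong n f≗0) (zeros n)
  where
  zeros : ∀ n → ∑[ j < n ] 0ℚ ≡ 0ℚ
  zeros zero    = refl
  zeros (suc n) = cong (_+ 0ℚ) (zeros n)

∑<-extend : ∀ {m n} (f : ℕ → ℚ) → m ≤ n → (∀ j → m ≤ j → j < n → f j ≡ 0ℚ) → ∑< m f ≡ ∑< n f
∑<-extend {n = zero}  f z≤n tail = refl
∑<-extend {m} {suc n} f m≤1+n tail with ℕₚ.m≤n⇒m<n∨m≡n m≤1+n
... | inj₂ refl      = refl
... | inj₁ (s≤s m≤n) = begin
  ∑< m f            ≡⟨ ∑<-extend f m≤n (λ j m≤j j<n → tail j m≤j (ℕₚ.m<n⇒m<1+n j<n)) ⟩
  ∑< n f            ≡⟨ ℚₚ.+-identityʳ (∑< n f) ⟨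
  ∑< n f + 0ℚ       ≡⟨ cong (λ x → ∑< n f + x) (tail n m≤n ℕₚ.≤-refl) ⟨
  ∑< n f + f n      ∎
  where open ≡-Reasoning

∑<-sucˡ : ∀ n (f : ℕ → ℚ) → ∑< (suc n) f ≡ f 0 + ∑[ j < n ] f (suc j)
∑<-sucˡ zero    f = trans (ℚₚ.+-identityˡ (f 0)) (sym (ℚₚ.+-identityʳ (f 0)))
∑<-sucˡ (suc n) f = trans (cong (_+ f (suc n)) (∑<-sucˡ n f)) (ℚₚ.+-assoc (f 0) _ (f (suc n)))

∑<-distrib-+ : ∀ n (f g : ℕ → ℚ) → ∑[ j < n ] (f j + g j) ≡ ∑< n f + ∑< n g
∑<-distrib-+ zero    f g = refl
∑<-distrib-+ (suc n) f g = trans (cong (_+ (f n + g n)) (∑<-distrib-+ n f g))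
                                 (interchange (∑< n f) (∑< n g) (f n) (g n))
  where
  interchange : ∀ a b c d → (a + b) + (c + d) ≡ (a + c) + (b + d)
  interchange = solve-∀ ℚ-ring

*-distribˡ-∑< : ∀ n c (f : ℕ → ℚ) → ∑[ j < n ] (c * f j) ≡ c * ∑< n f
*-distribˡ-∑< zero    c f = sym (ℚₚ.*-zeroʳ c)
*-distribˡ-∑< (suc n) c f = trans (cong (_+ c * f n) (*-distribˡ-∑< n c f)) (sym (ℚₚ.*-distribˡ-+ c (∑< n f) (f n)))

∑<-comm : ∀ m n (f : ℕ → ℕ → ℚ) → ∑[ i < m ] ∑[ j < n ] f i j ≡ ∑[ j < n ] ∑[ i < m ] f i j
∑<-comm zero    n f = sym (∑<-zero n (λ _ → 0ℚ) (λ _ _ → refl))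
∑<-comm (suc m) n f = trans (cong (_+ ∑< n (f m)) (∑<-comm m n f))
                            (sym (∑<-distrib-+ n (λ j → ∑[ i < m ] f i j) (f m)))

-- Generalised binomial coefficients

ℕ→ℚ-suc : ∀ n → ℕ→ℚ (suc n) ≡ 1ℚ + ℕ→ℚ n
ℕ→ℚ-suc = ℕ→ℚ-homo-+ 1

falling-+1 : ∀ y N → falling (y + 1ℚ) (suc N) ≡ (y + 1ℚ) * falling y N
falling-+1 y zero    = single-factor y
  where
  single-factor : ∀ y → 1ℚ * (y + 1ℚ - 0ℚ) ≡ (y + 1ℚ) * 1ℚ
  single-factor = solve-∀ ℚ-ring
falling-+1 y (suc N) = begin
  falling (y + 1ℚ) (suc N) * (y + 1ℚ - ℕ→ℚ (suc N))  ≡⟨ cong₂ (λ F n → F * (y + 1ℚ - n)) (falling-+1 y N) (ℕ→ℚ-suc N) ⟩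
  (y + 1ℚ) * falling y N * (y + 1ℚ - (1ℚ + ℕ→ℚ N))  ≡⟨ regroup y (falling y N) (ℕ→ℚ N) ⟩
  (y + 1ℚ) * (falling y N * (y - ℕ→ℚ N))            ∎
  where
  open ≡-Reasoning
  regroup : ∀ y F n → (y + 1ℚ) * F * (y + 1ℚ - (1ℚ + n)) ≡ (y + 1ℚ) * (F * (y - n))
  regroup = solve-∀ ℚ-ring

genBinom-pascal : ∀ z N → genBinom (z + 1ℚ) (suc N) ≡ genBinom z (suc N) + genBinom z N
genBinom-pascal z N = begin
  falling (z + 1ℚ) (suc N) * invFact (suc N)
    ≡⟨ cong (_* invFact (suc N)) (falling-+1 z N) ⟩
  (z + 1ℚ) * falling z N * invFact (suc N)
    ≡⟨ split z (falling z N) (invFact (suc N)) (ℕ→ℚ N) ⟩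
  falling z N * (z - ℕ→ℚ N) * invFact (suc N) + falling z N * (invFact (suc N) * (1ℚ + ℕ→ℚ N))
    ≡⟨ cong (λ c → genBinom z (suc N) + falling z N * (invFact (suc N) * c)) (ℕ→ℚ-suc N) ⟨
  genBinom z (suc N) + falling z N * (invFact (suc N) * ℕ→ℚ (suc N))
    ≡⟨ cong (λ c → genBinom z (suc N) + falling z N * c) (invFact-suc N) ⟩
  genBinom z (suc N) + genBinom z N ∎
  where
  open ≡-Reasoning
  split : ∀ z F I n → (z + 1ℚ) * F * I ≡ F * (z - n) * I + F * (I * (1ℚ + n))
  split = solve-∀ ℚ-ring

multichoose : ℚ → ℕ → ℚ
multichoose x N = genBinom (x + ℕ→ℚ N - 1ℚ) N

multichoose-suc-genBinom : ∀ y N → multichoose y (suc N) ≡ genBinom (y + ℕ→ℚ N - 1ℚ + 1ℚ) (suc N)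
multichoose-suc-genBinom y N =
  cong (λ z → genBinom z (suc N)) (trans (cong (λ n → y + n - 1ℚ) (ℕ→ℚ-suc N)) (shift-out y (ℕ→ℚ N)))
  where
  shift-out : ∀ y n → y + (1ℚ + n) - 1ℚ ≡ y + n - 1ℚ + 1ℚ
  shift-out = solve-∀ ℚ-ring

multichoose-pascal : ∀ y N → multichoose y (suc N) ≡ multichoose (y - 1ℚ) (suc N) + multichoose y N
multichoose-pascal y N = begin
  multichoose y (suc N)
    ≡⟨ multichoose-suc-genBinom y N ⟩
  genBinom (y + ℕ→ℚ N - 1ℚ + 1ℚ) (suc N)
    ≡⟨ genBinom-pascal (y + ℕ→ℚ N - 1ℚ) N ⟩
  genBinom (y + ℕ→ℚ N - 1ℚ) (suc N) + multichoose y N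
    ≡⟨ cong (λ z → genBinom z (suc N) + multichoose y N) (shift-in y (ℕ→ℚ N)) ⟩
  genBinom (y - 1ℚ + ℕ→ℚ N - 1ℚ + 1ℚ) (suc N) + multichoose y N
    ≡⟨ cong (_+ multichoose y N) (multichoose-suc-genBinom (y - 1ℚ) N) ⟨
  multichoose (y - 1ℚ) (suc N) + multichoose y N ∎
  where
  open ≡-Reasoning
  shift-in : ∀ y n → y + n - 1ℚ ≡ y - 1ℚ + n - 1ℚ + 1ℚ
  shift-in = solve-∀ ℚ-ring

multichoose-suc : ∀ x N → ℕ→ℚ (suc N) * multichoose x (suc N) ≡ (x + ℕ→ℚ N) * multichoose x N
multichoose-suc x N = begin
  ℕ→ℚ (suc N) * multichoose x (suc N)
    ≡⟨ cong (ℕ→ℚ (suc N) *_) (multichoose-suc-genBinom x N) ⟩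
  ℕ→ℚ (suc N) * (falling (y + 1ℚ) (suc N) * invFact (suc N))
    ≡⟨ cong (λ F → ℕ→ℚ (suc N) * (F * invFact (suc N))) (falling-+1 y N) ⟩
  ℕ→ℚ (suc N) * ((y + 1ℚ) * falling y N * invFact (suc N))
    ≡⟨ regroup (ℕ→ℚ (suc N)) (y + 1ℚ) (falling y N) (invFact (suc N)) ⟩
  (y + 1ℚ) * (falling y N * (invFact (suc N) * ℕ→ℚ (suc N)))
    ≡⟨ cong₂ (λ c I → c * (falling y N * I)) (unshift x (ℕ→ℚ N)) (invFact-suc N) ⟩
  (x + ℕ→ℚ N) * multichoose x N ∎
  where
  open ≡-Reasoning
  y = x + ℕ→ℚ N - 1ℚ
  regroup : ∀ m c F I → m * (c * F * I) ≡ c * (F * (I * m))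
  regroup = solve-∀ ℚ-ring
  unshift : ∀ x n → x + n - 1ℚ + 1ℚ ≡ x + n
  unshift = solve-∀ ℚ-ring

alternatingSum : ℕ → ℚ → ℕ → ℚ
alternatingSum m x n = ∑[ u < suc n ] ((- 1ℚ) ^ℚ u * ℕ→ℚ (m C u) * multichoose x (n ∸ u))

alternatingSum-suc : ∀ m x n → alternatingSum (suc m) x (suc n) ≡ alternatingSum m x (suc n) - alternatingSum m x n
alternatingSum-suc m x n = begin
  alternatingSum (suc m) x (suc n)
    ≡⟨ ∑<-sucˡ (suc n) (summand (suc m) (suc n)) ⟩
  head + ∑[ u < suc n ] summand (suc m) (suc n) (suc u)
    ≡⟨ cong (λ s → head + s) (∑<-cong (suc n) λ u _ → pascal u) ⟩
  head + ∑[ u < suc n ] (- 1ℚ * summand m n u + summand m (suc n) (suc u))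
    ≡⟨ cong (λ s → head + s) (∑<-distrib-+ (suc n) (λ u → - 1ℚ * summand m n u) (λ u → summand m (suc n) (suc u))) ⟩
  head + (∑[ u < suc n ] (- 1ℚ * summand m n u) + tail)
    ≡⟨ cong (λ s → head + (s + tail)) (*-distribˡ-∑< (suc n) (- 1ℚ) (summand m n)) ⟩
  head + (- 1ℚ * alternatingSum m x n + tail)
    ≡⟨ reassociate head (alternatingSum m x n) tail ⟩
  (head + tail) - alternatingSum m x n
    ≡⟨ cong (_- alternatingSum m x n) (∑<-sucˡ (suc n) (summand m (suc n))) ⟨
  alternatingSum m x (suc n) - alternatingSum m x n ∎
  where
  open ≡-Reasoning
  summand : ℕ → ℕ → ℕ → ℚ
  summand m n u = (- 1ℚ) ^ℚ u * ℕ→ℚ (m C u) * multichoose x (n ∸ u)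
  head = 1ℚ * 1ℚ * multichoose x (suc n)
  tail = ∑[ u < suc n ] summand m (suc n) (suc u)
  pascal : ∀ u → summand (suc m) (suc n) (suc u) ≡ - 1ℚ * summand m n u + summand m (suc n) (suc u)
  pascal u = trans (cong (λ c → (- 1ℚ) ^ℚ suc u * ℕ→ℚ c * multichoose x (n ∸ u)) (sym (nCk+nC[k+1]≡[n+1]C[k+1] m u)))
                   (trans (cong (λ c → (- 1ℚ) ^ℚ suc u * c * multichoose x (n ∸ u)) (ℕ→ℚ-homo-+ (m C u) (m C suc u)))
                          (distribute ((- 1ℚ) ^ℚ u) (ℕ→ℚ (m C u)) (ℕ→ℚ (m C suc u)) (multichoose x (n ∸ u))))
    where
    distribute : ∀ σ a b M → (- 1ℚ * σ) * (a + b) * M ≡ - 1ℚ * (σ * a * M) + (- 1ℚ * σ) * b * M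
    distribute = solve-∀ ℚ-ring
  reassociate : ∀ a b c → a + (- 1ℚ * b + c) ≡ (a + c) - b
  reassociate = solve-∀ ℚ-ring

alternatingSum≡multichoose : ∀ m x n → alternatingSum m x n ≡ multichoose (x - ℕ→ℚ m) n
alternatingSum≡multichoose zero x n = begin
  alternatingSum 0 x n                  ≡⟨ ∑<-sucˡ n _ ⟩
  1ℚ * 1ℚ * multichoose x n + ∑[ u < n ] ((- 1ℚ) ^ℚ suc u * 0ℚ * multichoose x (n ∸ suc u))
    ≡⟨ cong (λ s → 1ℚ * 1ℚ * multichoose x n + s) (∑<-zero n _ λ u _ → vanish u) ⟩
  1ℚ * 1ℚ * multichoose x n + 0ℚ        ≡⟨ drop-units (multichoose x n) ⟩
  multichoose x n                       ≡⟨ cong (λ y → multichoose y n) (ℚₚ.+-identityʳ x) ⟨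
  multichoose (x - 0ℚ) n                ∎
  where
  open ≡-Reasoning
  vanish : ∀ u → (- 1ℚ) ^ℚ suc u * 0ℚ * multichoose x (n ∸ suc u) ≡ 0ℚ
  vanish u = trans (cong (_* multichoose x (n ∸ suc u)) (ℚₚ.*-zeroʳ ((- 1ℚ) ^ℚ suc u)))
                   (ℚₚ.*-zeroˡ (multichoose x (n ∸ suc u)))
  drop-units : ∀ M → 1ℚ * 1ℚ * M + 0ℚ ≡ M
  drop-units = solve-∀ ℚ-ring
alternatingSum≡multichoose (suc m) x zero    = refl
alternatingSum≡multichoose (suc m) x (suc n) = begin
  alternatingSum (suc m) x (suc n)                                 ≡⟨ alternatingSum-suc m x n ⟩
  alternatingSum m x (suc n) - alternatingSum m x n               ≡⟨ cong₂ _-_ (alternatingSum≡multichoose m x (suc n))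
                                                                                (alternatingSum≡multichoose m x n) ⟩
  multichoose y (suc n) - multichoose y n                         ≡⟨ cong (_- multichoose y n) (multichoose-pascal y n) ⟩
  multichoose (y - 1ℚ) (suc n) + multichoose y n - multichoose y n ≡⟨ cancel-right (multichoose (y - 1ℚ) (suc n)) (multichoose y n) ⟩
  multichoose (y - 1ℚ) (suc n)                                     ≡⟨ cong (λ z → multichoose z (suc n)) x-[1+m]≡y-1 ⟨
  multichoose (x - ℕ→ℚ (suc m)) (suc n)                            ∎
  where
  open ≡-Reasoning
  y = x - ℕ→ℚ m
  cancel-right : ∀ a b → a + b - b ≡ a
  cancel-right = solve-∀ ℚ-ring
  x-[1+m]≡y-1 : x - ℕ→ℚ (suc m) ≡ y - 1ℚ
  x-[1+m]≡y-1 = trans (cong (λ c → x - c) (ℕ→ℚ-suc m)) (sub-suc x (ℕ→ℚ m))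
    where
    sub-suc : ∀ x m → x - (1ℚ + m) ≡ x - m - 1ℚ
    sub-suc = solve-∀ ℚ-ring

-- The diagonal sums E(N)

data DiagonalView (M t : ℕ) : Set where
  on  : ∀ s → 2 ℕ.* t ℕ.+ s ≡ M → DiagonalView M t
  off : M < 2 ℕ.* t → DiagonalView M t

diagonalView : ∀ M t → DiagonalView M t
diagonalView M t with 2 ℕ.* t ℕ.≤? M
... | yes 2t≤M = on (M ∸ 2 ℕ.* t) (ℕₚ.m+[n∸m]≡n 2t≤M)
... | no  2t≰M = off (ℕₚ.≰⇒> 2t≰M)

<2t⇒1+<2[1+t] : ∀ {M t} → M < 2 ℕ.* t → suc M < 2 ℕ.* suc t
<2t⇒1+<2[1+t] {M} {t} M<2t = subst (suc M <_) (sym (ℕₚ.*-suc 2 t)) (s≤s (ℕₚ.m<n⇒m<1+n M<2t))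

module DiagonalSum (a : ℤ) where

  x : ℚ
  x = ℤ→ℚ a + ℕ→ℚ 2

  dfRatio-suc : ∀ r → dfRatio a (suc r) ≡ dfRatio a r * (x + ℕ→ℚ 2 * ℕ→ℚ r)
  dfRatio-suc r = cong (dfRatio a r *_) (begin
    ℤ→ℚ (a ℤ.+ + (2 ℕ.* suc r))         ≡⟨ ℤ→ℚ-homo-+ a (+ (2 ℕ.* suc r)) ⟩
    ℤ→ℚ a + ℕ→ℚ (2 ℕ.* suc r)           ≡⟨ cong (λ c → ℤ→ℚ a + c) (ℕ→ℚ-homo-* 2 (suc r)) ⟩
    ℤ→ℚ a + ℕ→ℚ 2 * ℕ→ℚ (suc r)         ≡⟨ cong (λ c → ℤ→ℚ a + ℕ→ℚ 2 * c) (ℕ→ℚ-suc r) ⟩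
    ℤ→ℚ a + ℕ→ℚ 2 * (1ℚ + ℕ→ℚ r)        ≡⟨ expand (ℤ→ℚ a) (ℕ→ℚ 2) (ℕ→ℚ r) ⟩
    x + ℕ→ℚ 2 * ℕ→ℚ r                   ∎)
    where
    open ≡-Reasoning
    expand : ∀ a two r → a + two * (1ℚ + r) ≡ a + two + two * r
    expand = solve-∀ ℚ-ring

  summand : ℕ → ℕ → ℚ
  summand t s = (- 1ℚ) ^ℚ t * ½ ^ℚ t * dfRatio a (t ℕ.+ s) * invFact s * invFact t

  summand-suc-s : ∀ t s → ℕ→ℚ (suc s) * summand t (suc s) ≡ (x + ℕ→ℚ 2 * ℕ→ℚ (t ℕ.+ s)) * summand t s
  summand-suc-s t s = begin
    ℕ→ℚ (suc s) * (ε * dfRatio a (t ℕ.+ suc s) * invFact (suc s) * invFact t)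
      ≡⟨ cong (λ r → ℕ→ℚ (suc s) * (ε * dfRatio a r * invFact (suc s) * invFact t)) (ℕₚ.+-suc t s) ⟩
    ℕ→ℚ (suc s) * (ε * dfRatio a (suc (t ℕ.+ s)) * invFact (suc s) * invFact t)
      ≡⟨ cong (λ D → ℕ→ℚ (suc s) * (ε * D * invFact (suc s) * invFact t)) (dfRatio-suc (t ℕ.+ s)) ⟩
    ℕ→ℚ (suc s) * (ε * (dfRatio a (t ℕ.+ s) * c) * invFact (suc s) * invFact t)
      ≡⟨ regroup (ℕ→ℚ (suc s)) ε (dfRatio a (t ℕ.+ s)) c (invFact (suc s)) (invFact t) ⟩
    c * (ε * dfRatio a (t ℕ.+ s) * (invFact (suc s) * ℕ→ℚ (suc s)) * invFact t)
      ≡⟨ cong (λ I → c * (ε * dfRatio a (t ℕ.+ s) * I * invFact t)) (invFact-suc s) ⟩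
    c * summand t s ∎
    where
    open ≡-Reasoning
    ε = (- 1ℚ) ^ℚ t * ½ ^ℚ t
    c = x + ℕ→ℚ 2 * ℕ→ℚ (t ℕ.+ s)
    regroup : ∀ n ε D c I J → n * (ε * (D * c) * I * J) ≡ c * (ε * D * (I * n) * J)
    regroup = solve-∀ ℚ-ring

  summand-suc-t : ∀ t s → ℕ→ℚ 2 * ℕ→ℚ (suc t) * summand (suc t) s ≡ - (ℕ→ℚ (suc s) * summand t (suc s))
  summand-suc-t t s = begin
    ℕ→ℚ 2 * ℕ→ℚ (suc t) * (- 1ℚ * σ * (½ * h) * D * invFact s * invFact (suc t))
      ≡⟨ cong (λ I → ℕ→ℚ 2 * ℕ→ℚ (suc t) * (- 1ℚ * σ * (½ * h) * D * I * invFact (suc t))) (invFact-suc s) ⟨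
    ℕ→ℚ 2 * ℕ→ℚ (suc t) * (- 1ℚ * σ * (½ * h) * D * (invFact (suc s) * ℕ→ℚ (suc s)) * invFact (suc t))
      ≡⟨ regroup (ℕ→ℚ (suc t)) σ h D (invFact (suc s)) (ℕ→ℚ (suc s)) (invFact (suc t)) ⟩
    - (ℕ→ℚ (suc s) * (σ * h * D * invFact (suc s) * (invFact (suc t) * ℕ→ℚ (suc t))))
      ≡⟨ cong (λ I → - (ℕ→ℚ (suc s) * (σ * h * D * invFact (suc s) * I))) (invFact-suc t) ⟩
    - (ℕ→ℚ (suc s) * (σ * h * D * invFact (suc s) * invFact t))
      ≡⟨ cong (λ r → - (ℕ→ℚ (suc s) * (σ * h * dfRatio a r * invFact (suc s) * invFact t))) (ℕₚ.+-suc t s) ⟨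
    - (ℕ→ℚ (suc s) * summand t (suc s)) ∎
    where
    open ≡-Reasoning
    σ = (- 1ℚ) ^ℚ t
    h = ½ ^ℚ t
    D = dfRatio a (suc t ℕ.+ s)
    regroup : ∀ n σ h D I m J →
              ℕ→ℚ 2 * n * (- 1ℚ * σ * (½ * h) * D * (I * m) * J) ≡ - (m * (σ * h * D * I * (J * n)))
    regroup = solve-∀ ℚ-ring

  diagonal : ℕ → ℕ → ℚ
  diagonal M t with diagonalView M t
  ... | on s _ = summand t s
  ... | off _  = 0ℚ

  diagonal-on : ∀ {M} t s → 2 ℕ.* t ℕ.+ s ≡ M → diagonal M t ≡ summand t s
  diagonal-on {M} t s eq with diagonalView M t
  ... | on s′ eq′ = cong (summand t) (ℕₚ.+-cancelˡ-≡ (2 ℕ.* t) s′ s (trans eq′ (sym eq)))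
  ... | off M<2t  = ⊥-elim (ℕₚ.<⇒≱ M<2t (subst (2 ℕ.* t ≤_) eq (ℕₚ.m≤m+n (2 ℕ.* t) s)))

  diagonal-off : ∀ {M} t → M < 2 ℕ.* t → diagonal M t ≡ 0ℚ
  diagonal-off {M} t M<2t with diagonalView M t
  ... | on s eq = ⊥-elim (ℕₚ.<⇒≱ M<2t (subst (2 ℕ.* t ≤_) eq (ℕₚ.m≤m+n (2 ℕ.* t) s)))
  ... | off _   = refl

  *-diagonal-split : ∀ M t → ℕ→ℚ M * diagonal M t ≡ ℕ→ℚ (M ∸ 2 ℕ.* t) * diagonal M t + ℕ→ℚ 2 * ℕ→ℚ t * diagonal M t
  *-diagonal-split M t with diagonalView M t
  ... | on s refl = begin
    ℕ→ℚ (2 ℕ.* t ℕ.+ s) * summand t s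
      ≡⟨ cong (_* summand t s) (trans (ℕ→ℚ-homo-+ (2 ℕ.* t) s) (cong (_+ ℕ→ℚ s) (ℕ→ℚ-homo-* 2 t))) ⟩
    (ℕ→ℚ 2 * ℕ→ℚ t + ℕ→ℚ s) * summand t s
      ≡⟨ split (ℕ→ℚ t) (ℕ→ℚ s) (summand t s) ⟩
    ℕ→ℚ s * summand t s + ℕ→ℚ 2 * ℕ→ℚ t * summand t s
      ≡⟨ cong (λ r → ℕ→ℚ r * summand t s + ℕ→ℚ 2 * ℕ→ℚ t * summand t s) (ℕₚ.m+n∸m≡n (2 ℕ.* t) s) ⟨
    ℕ→ℚ (2 ℕ.* t ℕ.+ s ∸ 2 ℕ.* t) * summand t s + ℕ→ℚ 2 * ℕ→ℚ t * summand t s ∎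
    where
    open ≡-Reasoning
    split : ∀ t s d → (ℕ→ℚ 2 * t + s) * d ≡ s * d + ℕ→ℚ 2 * t * d
    split = solve-∀ ℚ-ring
  ... | off _ = annihilate (ℕ→ℚ M) (ℕ→ℚ (M ∸ 2 ℕ.* t)) (ℕ→ℚ t)
    where
    annihilate : ∀ m w t → m * 0ℚ ≡ w * 0ℚ + ℕ→ℚ 2 * t * 0ℚ
    annihilate = solve-∀ ℚ-ring

  diagonal-suc-t : ∀ t s → ℕ→ℚ 2 * ℕ→ℚ (suc t) * diagonal (suc (2 ℕ.* t ℕ.+ s)) (suc t) ≡ - (ℕ→ℚ s * summand t s)
  diagonal-suc-t t zero = begin
    ℕ→ℚ 2 * ℕ→ℚ (suc t) * diagonal (suc (2 ℕ.* t ℕ.+ 0)) (suc t)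
      ≡⟨ cong (ℕ→ℚ 2 * ℕ→ℚ (suc t) *_) (diagonal-off (suc t) past-diagonal) ⟩
    ℕ→ℚ 2 * ℕ→ℚ (suc t) * 0ℚ
      ≡⟨ both-zero (ℕ→ℚ (suc t)) (summand t 0) ⟩
    - (0ℚ * summand t 0) ∎
    where
    open ≡-Reasoning
    past-diagonal : suc (2 ℕ.* t ℕ.+ 0) < 2 ℕ.* suc t
    past-diagonal = subst₂ _<_ (cong suc (sym (ℕₚ.+-identityʳ (2 ℕ.* t)))) (sym (ℕₚ.*-suc 2 t)) (ℕₚ.n<1+n (suc (2 ℕ.* t)))
    both-zero : ∀ n f → ℕ→ℚ 2 * n * 0ℚ ≡ - (0ℚ * f)
    both-zero = solve-∀ ℚ-ring
  diagonal-suc-t t (suc s) = trans (cong (ℕ→ℚ 2 * ℕ→ℚ (suc t) *_) (diagonal-on (suc t) s on-diagonal)) (summand-suc-t t s)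
    where
    on-diagonal : 2 ℕ.* suc t ℕ.+ s ≡ suc (2 ℕ.* t ℕ.+ suc s)
    on-diagonal = shift t s
      where
      shift : ∀ t s → 2 ℕ.* suc t ℕ.+ s ≡ suc (2 ℕ.* t ℕ.+ suc s)
      shift = ℕ-Solver.solve-∀

  diagonal-recurrence : ∀ N t → ℕ→ℚ (suc N ∸ 2 ℕ.* t) * diagonal (suc N) t + ℕ→ℚ 2 * ℕ→ℚ (suc t) * diagonal (suc N) (suc t)
                          ≡ (x + ℕ→ℚ N) * diagonal N t
  diagonal-recurrence N t with diagonalView N t
  ... | on s refl = begin
    ℕ→ℚ (suc (2 ℕ.* t ℕ.+ s) ∸ 2 ℕ.* t) * diagonal (suc (2 ℕ.* t ℕ.+ s)) t + next
      ≡⟨ cong₂ (λ w d → ℕ→ℚ w * d + next) width (diagonal-on t (suc s) (ℕₚ.+-suc (2 ℕ.* t) s)) ⟩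
    ℕ→ℚ (suc s) * summand t (suc s) + next
      ≡⟨ cong₂ _+_ (summand-suc-s t s) (diagonal-suc-t t s) ⟩
    (x + ℕ→ℚ 2 * ℕ→ℚ (t ℕ.+ s)) * summand t s + - (ℕ→ℚ s * summand t s)
      ≡⟨ cong (λ c → (x + ℕ→ℚ 2 * c) * summand t s + - (ℕ→ℚ s * summand t s)) (ℕ→ℚ-homo-+ t s) ⟩
    (x + ℕ→ℚ 2 * (ℕ→ℚ t + ℕ→ℚ s)) * summand t s + - (ℕ→ℚ s * summand t s)
      ≡⟨ combine x (ℕ→ℚ t) (ℕ→ℚ s) (summand t s) ⟩
    (x + (ℕ→ℚ 2 * ℕ→ℚ t + ℕ→ℚ s)) * summand t s
      ≡⟨ cong (λ c → (x + c) * summand t s) (trans (ℕ→ℚ-homo-+ (2 ℕ.* t) s) (cong (_+ ℕ→ℚ s) (ℕ→ℚ-homo-* 2 t))) ⟨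
    (x + ℕ→ℚ (2 ℕ.* t ℕ.+ s)) * summand t s ∎
    where
    open ≡-Reasoning
    next = ℕ→ℚ 2 * ℕ→ℚ (suc t) * diagonal (suc (2 ℕ.* t ℕ.+ s)) (suc t)
    width : suc (2 ℕ.* t ℕ.+ s) ∸ 2 ℕ.* t ≡ suc s
    width = trans (cong (_∸ 2 ℕ.* t) (sym (ℕₚ.+-suc (2 ℕ.* t) s))) (ℕₚ.m+n∸m≡n (2 ℕ.* t) (suc s))
    combine : ∀ x t s f → (x + ℕ→ℚ 2 * (t + s)) * f + - (s * f) ≡ (x + (ℕ→ℚ 2 * t + s)) * f
    combine = solve-∀ ℚ-ring
  ... | off N<2t = begin
    ℕ→ℚ (suc N ∸ 2 ℕ.* t) * diagonal (suc N) t + ℕ→ℚ 2 * ℕ→ℚ (suc t) * diagonal (suc N) (suc t)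
      ≡⟨ cong₂ (λ w d → ℕ→ℚ w * diagonal (suc N) t + ℕ→ℚ 2 * ℕ→ℚ (suc t) * d)
               (ℕₚ.m≤n⇒m∸n≡0 N<2t) (diagonal-off (suc t) (<2t⇒1+<2[1+t] N<2t)) ⟩
    0ℚ * diagonal (suc N) t + ℕ→ℚ 2 * ℕ→ℚ (suc t) * 0ℚ
      ≡⟨ annihilate (diagonal (suc N) t) (ℕ→ℚ (suc t)) (x + ℕ→ℚ N) ⟩
    (x + ℕ→ℚ N) * 0ℚ ∎
    where
    open ≡-Reasoning
    annihilate : ∀ d t y → 0ℚ * d + ℕ→ℚ 2 * t * 0ℚ ≡ y * 0ℚ
    annihilate = solve-∀ ℚ-ring

  diagonalSum : ℕ → ℚ
  diagonalSum N = ∑[ t < suc N ] diagonal N t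

  diagonalSum-suc : ∀ N → ℕ→ℚ (suc N) * diagonalSum (suc N) ≡ (x + ℕ→ℚ N) * diagonalSum N
  diagonalSum-suc N = begin
    ℕ→ℚ (suc N) * ∑< (suc (suc N)) (diagonal (suc N))
      ≡⟨ *-distribˡ-∑< (suc (suc N)) (ℕ→ℚ (suc N)) (diagonal (suc N)) ⟨
    ∑[ t < suc (suc N) ] (ℕ→ℚ (suc N) * diagonal (suc N) t)
      ≡⟨ ∑<-cong (suc (suc N)) (λ t _ → *-diagonal-split (suc N) t) ⟩
    ∑[ t < suc (suc N) ] (along t + across t)
      ≡⟨ ∑<-distrib-+ (suc (suc N)) along across ⟩
    ∑< (suc (suc N)) along + ∑< (suc (suc N)) across
      ≡⟨ cong₂ _+_ last-along-vanishes (∑<-sucˡ (suc N) across) ⟩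
    ∑< (suc N) along + (across 0 + ∑[ t < suc N ] across (suc t))
      ≡⟨ cong (λ c → ∑< (suc N) along + c) (trans (cong (_+ ∑[ t < suc N ] across (suc t)) (ℚₚ.*-zeroˡ (diagonal (suc N) 0)))
                                                  (ℚₚ.+-identityˡ _)) ⟩
    ∑< (suc N) along + ∑[ t < suc N ] across (suc t)
      ≡⟨ ∑<-distrib-+ (suc N) along (λ t → across (suc t)) ⟨
    ∑[ t < suc N ] (along t + across (suc t))
      ≡⟨ ∑<-cong (suc N) (λ t _ → diagonal-recurrence N t) ⟩
    ∑[ t < suc N ] ((x + ℕ→ℚ N) * diagonal N t)
      ≡⟨ *-distribˡ-∑< (suc N) (x + ℕ→ℚ N) (diagonal N) ⟩
    (x + ℕ→ℚ N) * diagonalSum N ∎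
    where
    open ≡-Reasoning
    along across : ℕ → ℚ
    along  t = ℕ→ℚ (suc N ∸ 2 ℕ.* t) * diagonal (suc N) t
    across t = ℕ→ℚ 2 * ℕ→ℚ t * diagonal (suc N) t
    last-along-vanishes : ∑< (suc (suc N)) along ≡ ∑< (suc N) along
    last-along-vanishes = trans (cong (λ w → ∑< (suc N) along + ℕ→ℚ w * diagonal (suc N) (suc N))
                                      (ℕₚ.m≤n⇒m∸n≡0 (ℕₚ.m≤n*m (suc N) 2)))
                                (trans (cong (λ c → ∑< (suc N) along + c) (ℚₚ.*-zeroˡ (diagonal (suc N) (suc N))))
                                       (ℚₚ.+-identityʳ _))

  diagonalSum≡multichoose : ∀ N → diagonalSum N ≡ multichoose x N
  diagonalSum≡multichoose zero    = refl
  diagonalSum≡multichoose (suc N) = ℕ→ℚ-*-cancelˡ (suc N) (begin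
    ℕ→ℚ (suc N) * diagonalSum (suc N)    ≡⟨ diagonalSum-suc N ⟩
    (x + ℕ→ℚ N) * diagonalSum N          ≡⟨ cong ((x + ℕ→ℚ N) *_) (diagonalSum≡multichoose N) ⟩
    (x + ℕ→ℚ N) * multichoose x N        ≡⟨ multichoose-suc x N ⟨
    ℕ→ℚ (suc N) * multichoose x (suc N)  ∎)
    where open ≡-Reasoning

m≡n+o+p⇒m∸n∸o≡p : ∀ {m} n o {p} → m ≡ n ℕ.+ o ℕ.+ p → m ∸ n ∸ o ≡ p
m≡n+o+p⇒m∸n∸o≡p {m} n o {p} refl = trans (ℕₚ.∸-+-assoc (n ℕ.+ o ℕ.+ p) n o) (ℕₚ.m+n∸m≡n (n ℕ.+ o) p)

-- Reindexing the double sum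

t≤⌊n/2⌋⇒2t≤n : ∀ n t → t ≤ ⌊ n /2⌋ → 2 ℕ.* t ≤ n
t≤⌊n/2⌋⇒2t≤n n             zero    _         = z≤n
t≤⌊n/2⌋⇒2t≤n (suc (suc n)) (suc t) (s≤s t≤h) =
  subst (_≤ suc (suc n)) (sym (ℕₚ.*-suc 2 t)) (s≤s (s≤s (t≤⌊n/2⌋⇒2t≤n n t t≤h)))

⌊n/2⌋<t⇒n<2t : ∀ n t → ⌊ n /2⌋ < t → n < 2 ℕ.* t
⌊n/2⌋<t⇒n<2t zero          (suc t) _         = subst (0 <_) (sym (ℕₚ.*-suc 2 t)) (s≤s z≤n)
⌊n/2⌋<t⇒n<2t (suc zero)    (suc t) _         = subst (1 <_) (sym (ℕₚ.*-suc 2 t)) (s≤s (s≤s z≤n))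
⌊n/2⌋<t⇒n<2t (suc (suc n)) (suc t) (s≤s h<t) =
  subst (suc (suc n) <_) (sym (ℕₚ.*-suc 2 t)) (s≤s (s≤s (⌊n/2⌋<t⇒n<2t n t h<t)))

n∸a<u⇒n∸u<a : ∀ {n a u} → u ≤ n → n ∸ a < u → n ∸ u < a
n∸a<u⇒n∸u<a {n} {a} {u} u≤n n∸a<u = ℕₚ.≰⇒> λ a≤n∸u →
  ℕₚ.<⇒≱ n∸a<u (ℕₚ.m+n≤o⇒m≤o∸n u (subst (_≤ n) (ℕₚ.+-comm a u) (ℕₚ.m≤o∸n⇒m+n≤o a u≤n a≤n∸u)))

multichoose-argument : ∀ n k i → i ≤ k →
  ℤ→ℚ (+ (4 ℕ.* k) ℤ.- + 3 ℤ.- + i) + ℕ→ℚ 2 - ℕ→ℚ (k ∸ i) + ℕ→ℚ n - 1ℚ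
  ≡ ℤ→ℚ (+ (n ℕ.+ 3 ℕ.* k) ℤ.- + 2)
multichoose-argument n k i i≤k with ℕₚ.m≤n⇒∃[o]m+o≡n i≤k
... | m , refl = begin
  ℤ→ℚ (+ (4 ℕ.* (i ℕ.+ m)) ℤ.- + 3 ℤ.- + i) + ℕ→ℚ 2 - ℕ→ℚ (i ℕ.+ m ∸ i) + ℕ→ℚ n - 1ℚ
    ≡⟨ cong₂ (λ a m′ → a + ℕ→ℚ 2 - m′ + ℕ→ℚ n - 1ℚ)
             (trans (ℤ→ℚ-homo-- (+ (4 ℕ.* (i ℕ.+ m)) ℤ.- + 3) (+ i))
                    (cong (_- ℕ→ℚ i) (trans (ℤ→ℚ-homo-- (+ (4 ℕ.* (i ℕ.+ m))) (+ 3)) (cong (_- ℕ→ℚ 3) (cast 4)))))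
             (cong ℕ→ℚ (ℕₚ.m+n∸m≡n i m)) ⟩
  ℕ→ℚ 4 * (ℕ→ℚ i + ℕ→ℚ m) - ℕ→ℚ 3 - ℕ→ℚ i + ℕ→ℚ 2 - ℕ→ℚ m + ℕ→ℚ n - 1ℚ
    ≡⟨ normalise (ℕ→ℚ i) (ℕ→ℚ m) (ℕ→ℚ n) ⟩
  ℕ→ℚ n + ℕ→ℚ 3 * (ℕ→ℚ i + ℕ→ℚ m) - ℕ→ℚ 2
    ≡⟨ cong (_- ℕ→ℚ 2) (trans (ℕ→ℚ-homo-+ n (3 ℕ.* (i ℕ.+ m))) (cong (λ c → ℕ→ℚ n + c) (cast 3))) ⟨
  ℕ→ℚ (n ℕ.+ 3 ℕ.* (i ℕ.+ m)) - ℕ→ℚ 2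
    ≡⟨ ℤ→ℚ-homo-- (+ (n ℕ.+ 3 ℕ.* (i ℕ.+ m))) (+ 2) ⟨
  ℤ→ℚ (+ (n ℕ.+ 3 ℕ.* (i ℕ.+ m)) ℤ.- + 2) ∎
  where
  open ≡-Reasoning
  cast : ∀ c → ℕ→ℚ (c ℕ.* (i ℕ.+ m)) ≡ ℕ→ℚ c * (ℕ→ℚ i + ℕ→ℚ m)
  cast c = trans (ℕ→ℚ-homo-* c (i ℕ.+ m)) (cong (ℕ→ℚ c *_) (ℕ→ℚ-homo-+ i m))
  normalise : ∀ i m n → ℕ→ℚ 4 * (i + m) - ℕ→ℚ 3 - i + ℕ→ℚ 2 - m + n - 1ℚ ≡ n + ℕ→ℚ 3 * (i + m) - ℕ→ℚ 2
  normalise = solve-∀ ℚ-ring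

module Reindexing (k i : ℕ) where

  open DiagonalSum (+ (4 ℕ.* k) ℤ.- + 3 ℤ.- + i) public

  cell : ℕ → ℕ → ℕ → ℚ
  cell n t u = (- 1ℚ) ^ℚ u * ℕ→ℚ ((k ∸ i) C u) * diagonal (n ∸ u) t

  term≡cell : ∀ {n} t u → 2 ℕ.* t ℕ.+ u ≤ n → term n k i (suc t) (suc u) ≡ pow2ℤ (+ n ℤ.- + 1) * cell n t u
  term≡cell t u 2t+u≤n with ℕₚ.m≤n⇒∃[o]m+o≡n 2t+u≤n
  ... | s , refl = begin
    negOnePowℤ (+ suc u ℤ.- + suc t) * pow2ℤ (+ n ℤ.- + suc t) * invFact (n ℕ.+ 3 ∸ 2 ℕ.* suc t ∸ suc u)
      * invFact t * Cᵤ * dfRatio a (n ℕ.+ 2 ∸ suc t ∸ suc u)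
      ≡⟨ cong₂ (λ σ p → σ * p * invFact (n ℕ.+ 3 ∸ 2 ℕ.* suc t ∸ suc u) * invFact t * Cᵤ * dfRatio a (n ℕ.+ 2 ∸ suc t ∸ suc u))
               (negOnePowℤ-- (suc u) (suc t)) (pow2ℤ-[n-1-t] n t) ⟩
    (- 1ℚ * σᵤ) * (- 1ℚ * σₜ) * (P * ½ ^ℚ t) * invFact (n ℕ.+ 3 ∸ 2 ℕ.* suc t ∸ suc u)
      * invFact t * Cᵤ * dfRatio a (n ℕ.+ 2 ∸ suc t ∸ suc u)
      ≡⟨ cong₂ (λ r r′ → (- 1ℚ * σᵤ) * (- 1ℚ * σₜ) * (P * ½ ^ℚ t) * invFact r * invFact t * Cᵤ * dfRatio a r′)
               (m≡n+o+p⇒m∸n∸o≡p (2 ℕ.* suc t) (suc u) (shape₁ t u s))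
               (m≡n+o+p⇒m∸n∸o≡p (suc t) (suc u) (shape₂ t u s)) ⟩
    (- 1ℚ * σᵤ) * (- 1ℚ * σₜ) * (P * ½ ^ℚ t) * invFact s * invFact t * Cᵤ * dfRatio a (t ℕ.+ s)
      ≡⟨ regroup σᵤ σₜ P (½ ^ℚ t) (invFact s) (invFact t) Cᵤ (dfRatio a (t ℕ.+ s)) ⟩
    P * (σᵤ * Cᵤ * summand t s)
      ≡⟨ cong (λ d → P * (σᵤ * Cᵤ * d)) (diagonal-on t s (sym n∸u≡2t+s)) ⟨
    P * cell n t u ∎
    where
    open ≡-Reasoning
    n = 2 ℕ.* t ℕ.+ u ℕ.+ s
    a = + (4 ℕ.* k) ℤ.- + 3 ℤ.- + i
    Cᵤ = ℕ→ℚ ((k ∸ i) C u)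
    P = pow2ℤ (+ n ℤ.- + 1)
    σᵤ = (- 1ℚ) ^ℚ u
    σₜ = (- 1ℚ) ^ℚ t
    shape₁ : ∀ t u s → 2 ℕ.* t ℕ.+ u ℕ.+ s ℕ.+ 3 ≡ 2 ℕ.* suc t ℕ.+ suc u ℕ.+ s
    shape₁ = ℕ-Solver.solve-∀
    shape₂ : ∀ t u s → 2 ℕ.* t ℕ.+ u ℕ.+ s ℕ.+ 2 ≡ suc t ℕ.+ suc u ℕ.+ (t ℕ.+ s)
    shape₂ = ℕ-Solver.solve-∀
    shape₃ : ∀ t u s → 2 ℕ.* t ℕ.+ u ℕ.+ s ≡ 2 ℕ.* t ℕ.+ s ℕ.+ u
    shape₃ = ℕ-Solver.solve-∀
    n∸u≡2t+s : n ∸ u ≡ 2 ℕ.* t ℕ.+ s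
    n∸u≡2t+s = trans (cong (_∸ u) (shape₃ t u s)) (ℕₚ.m+n∸n≡m (2 ℕ.* t ℕ.+ s) u)
    regroup : ∀ σᵤ σₜ P h I J C D → (- 1ℚ * σᵤ) * (- 1ℚ * σₜ) * (P * h) * I * J * C * D ≡ P * (σᵤ * C * (σₜ * h * D * I * J))
    regroup = solve-∀ ℚ-ring

  cell-off-diagonal : ∀ n t u → n ∸ u < 2 ℕ.* t → cell n t u ≡ 0ℚ
  cell-off-diagonal n t u n∸u<2t =
    trans (cong (c *_) (diagonal-off t n∸u<2t)) (ℚₚ.*-zeroʳ c)
    where c = (- 1ℚ) ^ℚ u * ℕ→ℚ ((k ∸ i) C u)

  cell-beyond-binomial : ∀ n t u → k ∸ i < u → cell n t u ≡ 0ℚ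
  cell-beyond-binomial n t u k∸i<u = begin
    (- 1ℚ) ^ℚ u * ℕ→ℚ ((k ∸ i) C u) * diagonal (n ∸ u) t
      ≡⟨ cong (λ c → (- 1ℚ) ^ℚ u * ℕ→ℚ c * diagonal (n ∸ u) t) (k>n⇒nCk≡0 k∸i<u) ⟩
    (- 1ℚ) ^ℚ u * 0ℚ * diagonal (n ∸ u) t                ≡⟨ cong (_* diagonal (n ∸ u) t) (ℚₚ.*-zeroʳ ((- 1ℚ) ^ℚ u)) ⟩
    0ℚ * diagonal (n ∸ u) t                              ≡⟨ ℚₚ.*-zeroˡ (diagonal (n ∸ u) t) ⟩
    0ℚ                                                   ∎
    where open ≡-Reasoning

  row : i ≤ k → ∀ n t → 2 ℕ.* t ≤ n →
        sumFromTo 1 ((n ℕ.+ 3 ∸ 2 ℕ.* suc t) ⊓ (k ℕ.+ 1 ∸ i)) (term n k i (suc t))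
        ≡ ∑[ u < suc n ] (pow2ℤ (+ n ℤ.- + 1) * cell n t u)
  row i≤k n t 2t≤n = begin
    sumFromTo 1 U (term n k i (suc t))  ≡⟨ sumFromTo-1 U (term n k i (suc t)) ⟩
    ∑[ u < U ] term n k i (suc t) (suc u) ≡⟨ ∑<-cong U (λ u u<U → term≡cell t u (2t+u≤n u<U)) ⟩
    ∑[ u < U ] (P * cell n t u)          ≡⟨ ∑<-extend (λ u → P * cell n t u) U≤1+n
                                                        (λ u U≤u u<1+n → trans (cong (P *_) (outside u U≤u u<1+n)) (ℚₚ.*-zeroʳ P)) ⟩
    ∑[ u < suc n ] (P * cell n t u)      ∎
    where
    open ≡-Reasoning
    P = pow2ℤ (+ n ℤ.- + 1)
    U = (n ℕ.+ 3 ∸ 2 ℕ.* suc t) ⊓ (k ℕ.+ 1 ∸ i)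
    d = n ∸ 2 ℕ.* t
    width : n ℕ.+ 3 ∸ 2 ℕ.* suc t ≡ suc d
    width = trans (cong (λ c → c ℕ.+ 3 ∸ 2 ℕ.* suc t) (sym (ℕₚ.m+[n∸m]≡n 2t≤n)))
                  (trans (cong (_∸ 2 ℕ.* suc t) (shift t d)) (ℕₚ.m+n∸m≡n (2 ℕ.* suc t) (suc d)))
      where
      shift : ∀ t d → 2 ℕ.* t ℕ.+ d ℕ.+ 3 ≡ 2 ℕ.* suc t ℕ.+ suc d
      shift = ℕ-Solver.solve-∀
    height : k ℕ.+ 1 ∸ i ≡ suc (k ∸ i)
    height = trans (ℕₚ.+-∸-comm 1 i≤k) (ℕₚ.+-comm (k ∸ i) 1)
    U≡ : U ≡ suc d ⊓ suc (k ∸ i)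
    U≡ = cong₂ _⊓_ width height
    2t+u≤n : ∀ {u} → u < U → 2 ℕ.* t ℕ.+ u ≤ n
    2t+u≤n {u} u<U = subst (_≤ n) (ℕₚ.+-comm u (2 ℕ.* t))
      (ℕₚ.m≤o∸n⇒m+n≤o u 2t≤n (ℕₚ.≤-pred (ℕₚ.m<n⊓o⇒m<n (suc d) (suc (k ∸ i)) (subst (u <_) U≡ u<U))))
    U≤1+n : U ≤ suc n
    U≤1+n = subst (_≤ suc n) (sym U≡) (ℕₚ.≤-trans (ℕₚ.m⊓n≤m (suc d) (suc (k ∸ i))) (s≤s (ℕₚ.m∸n≤m n (2 ℕ.* t))))
    outside : ∀ u → U ≤ u → u < suc n → cell n t u ≡ 0ℚ
    outside u U≤u u<1+n with ℕₚ.⊓-sel (suc d) (suc (k ∸ i))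
    ... | inj₁ U≡1+d = cell-off-diagonal n t u (n∸a<u⇒n∸u<a (ℕₚ.≤-pred u<1+n) (subst (_≤ u) (trans U≡ U≡1+d) U≤u))
    ... | inj₂ U≡1+m = cell-beyond-binomial n t u (subst (_≤ u) (trans U≡ U≡1+m) U≤u)

  lhs≡∑cells : i ≤ k → ∀ n → lhs n k i ≡ ∑[ t < suc n ] ∑[ u < suc n ] (pow2ℤ (+ n ℤ.- + 1) * cell n t u)
  lhs≡∑cells i≤k n = begin
    lhs n k i
      ≡⟨ sumFromTo-1 (suc ⌊ n /2⌋) _ ⟩
    ∑[ t < suc ⌊ n /2⌋ ] sumFromTo 1 ((n ℕ.+ 3 ∸ 2 ℕ.* suc t) ⊓ (k ℕ.+ 1 ∸ i)) (term n k i (suc t))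
      ≡⟨ ∑<-cong (suc ⌊ n /2⌋) (λ t t≤h → row i≤k n t (t≤⌊n/2⌋⇒2t≤n n t (ℕₚ.≤-pred t≤h))) ⟩
    ∑[ t < suc ⌊ n /2⌋ ] ∑[ u < suc n ] (P * cell n t u)
      ≡⟨ ∑<-extend (λ t → ∑[ u < suc n ] (P * cell n t u)) (s≤s (ℕₚ.⌊n/2⌋≤n n))
                   (λ t h<t _ → ∑<-zero (suc n) _ (λ u _ → empty-row t u h<t)) ⟩
    ∑[ t < suc n ] ∑[ u < suc n ] (P * cell n t u) ∎
    where
    open ≡-Reasoning
    P = pow2ℤ (+ n ℤ.- + 1)
    empty-row : ∀ t u → ⌊ n /2⌋ < t → P * cell n t u ≡ 0ℚ
    empty-row t u h<t = trans (cong (P *_) (cell-off-diagonal n t u (ℕₚ.≤-<-trans (ℕₚ.m∸n≤m n u) (⌊n/2⌋<t⇒n<2t n t h<t))))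
                              (ℚₚ.*-zeroʳ P)

  column : ∀ n u → ∑[ t < suc n ] cell n t u ≡ (- 1ℚ) ^ℚ u * ℕ→ℚ ((k ∸ i) C u) * multichoose x (n ∸ u)
  column n u = begin
    ∑[ t < suc n ] (c * diagonal (n ∸ u) t)  ≡⟨ *-distribˡ-∑< (suc n) c (diagonal (n ∸ u)) ⟩
    c * ∑< (suc n) (diagonal (n ∸ u))        ≡⟨ cong (c *_) (∑<-extend (diagonal (n ∸ u)) (s≤s (ℕₚ.m∸n≤m n u)) beyond) ⟨
    c * diagonalSum (n ∸ u)                  ≡⟨ cong (c *_) (diagonalSum≡multichoose (n ∸ u)) ⟩
    c * multichoose x (n ∸ u)                ∎
    where
    open ≡-Reasoning
    c = (- 1ℚ) ^ℚ u * ℕ→ℚ ((k ∸ i) C u)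
    beyond : ∀ t → suc (n ∸ u) ≤ t → t < suc n → diagonal (n ∸ u) t ≡ 0ℚ
    beyond t n∸u<t _ = diagonal-off t (ℕₚ.<-≤-trans n∸u<t (ℕₚ.m≤n*m t 2))

lemma2p11 : (n k i : ℕ) → i ≤ k → lhs n k i ≡ rhs n k
lemma2p11 n k i i≤k = begin
  lhs n k i
    ≡⟨ lhs≡∑cells i≤k n ⟩
  ∑[ t < suc n ] ∑[ u < suc n ] (P * cell n t u)
    ≡⟨ ∑<-comm (suc n) (suc n) (λ t u → P * cell n t u) ⟩
  ∑[ u < suc n ] ∑[ t < suc n ] (P * cell n t u)
    ≡⟨ ∑<-cong (suc n) (λ u _ → trans (*-distribˡ-∑< (suc n) P (λ t → cell n t u)) (cong (P *_) (column n u))) ⟩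
  ∑[ u < suc n ] (P * ((- 1ℚ) ^ℚ u * ℕ→ℚ ((k ∸ i) C u) * multichoose x (n ∸ u)))
    ≡⟨ *-distribˡ-∑< (suc n) P (λ u → (- 1ℚ) ^ℚ u * ℕ→ℚ ((k ∸ i) C u) * multichoose x (n ∸ u)) ⟩
  P * alternatingSum (k ∸ i) x n
    ≡⟨ cong (P *_) (alternatingSum≡multichoose (k ∸ i) x n) ⟩
  P * multichoose (x - ℕ→ℚ (k ∸ i)) n
    ≡⟨ cong (λ y → P * genBinom y n) (multichoose-argument n k i i≤k) ⟩
  rhs n k ∎
  where
  open ≡-Reasoning
  open Reindexing k i
  P = pow2ℤ (+ n ℤ.- + 1)
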